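{- Let $b=2$. For every $n\ge2$, $$B(n)=K(\lceil n/2\rceil)+K(\lfloor n/2\rfloor)+2,\qquad K(n)=2^{B(n)}+1+K(\lfloor n/2\rfloor),$$ and $K(n)>2K(n-1)$.
   Context: Base $b=2$. For $v\in\mathbb{N}$, $s(v)$ is the number of ones in the binary expansion of $v$, $f(v)=v+s(v)$, and $F(u)=|\{v\in\mathbb{N}: f(v)=u\}|$. $K(n)$ is the smallest $u\in\mathbb{N}$ with $F(u)=n$ (so $K(1)=0$), and for $n\ge2$, $B(n)=\lfloor\log_2 K(n)\rfloor$. -}

module Defs where

open import Data.Nat using (ℕ; zero; suc; _+_; _*_; _<_; _%_; ⌊_/2⌋)
open import Data.Nat.Properties using (_≟_)
open import Data.List using (List; length; filter; upTo)
open import Relation.Binary.PropositionalEquality using (_≡_; _≢_)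
open import Data.Product using (_×_)

-- sum of binary digits of m, using k as fuel (k ≥ number of binary digits suffices)
digitSum₂ : ℕ → ℕ → ℕ
digitSum₂ zero    m = 0
digitSum₂ (suc k) m = m % 2 + digitSum₂ k ⌊ m /2⌋

-- s(v): number of ones in the binary expansion of v (fuel v suffices, as v < 2^v)
s : ℕ → ℕ
s v = digitSum₂ v v

f : ℕ → ℕ
f v = v + s v

-- F(u) = |{ v ∈ ℕ : f(v) = u }|; since f(v) ≥ v, only v ∈ {0,…,u} can occur
F : ℕ → ℕ
F u = length (filter (λ v → f v ≟ u) (upTo (suc u)))

IsK : ℕ → ℕ → Set
IsK n u = (F u ≡ n) × (∀ w → w < u → F w ≢ n)

-- Define K by K n = 2^(K ⌈n/2⌉ + K ⌊n/2⌋ + 2) + 1 + K ⌊n/2⌋; everything then reduces to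
-- showing that K n is the least u with F u = n. Write u = 2^B + t with t < 2^B. A preimage
-- of u under f is either 2^B + w with f w + 1 = t, or some v < 2^B, whose complement
-- i = 2^B - 1 - v satisfies s v + s i = B, so that f v = u exactly when f i + t + 1 = B.
-- Hence F (2^B + t) = F (B - t - 1) + F (t - 1) (terms with negative argument omitted);
-- in particular F (2^(c+t+2) + 1 + t) = F c + F t, which gives F (K n) = n. If F u = n,
-- then either some smaller w has F w = n, or u = 2^(c+t+2) + 1 + t with F c + F t = n.
-- In the latter case the convexity K ⌈n/2⌉ + K ⌊n/2⌋ ≤ K x + K y for x + y = n, a
-- consequence of the growth K n > 2 K (n - 1), gives K ⌈n/2⌉ + K ⌊n/2⌋ ≤ c + t, with
-- equality only if t ≥ K ⌊n/2⌋; either way K n ≤ u.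
module Submission where

open import Defs
open import Data.Nat using (ℕ; _+_; _*_; _^_; _≥_; _>_; _∸_; ⌊_/2⌋; ⌈_/2⌉)
open import Data.Nat.Logarithm using (⌊log₂_⌋)
open import Data.Product using (Σ; _×_)
open import Relation.Binary.PropositionalEquality using (_≡_)

open import Level using (Level; 0ℓ)
open import Function.Base using (_∘_)
open import Function.Bundles using (_⇔_; mk⇔)
open import Data.Bool.Base using (true; false; if_then_else_)
open import Data.List.Base using (length; filter; upTo; [_]; _++_)
open import Data.List.Properties using (upTo-∷ʳ; length-++; filter-++)
open import Data.Nat.Base
  using (zero; suc; _≤_; _<_; _≤′_; ≤′-refl; ≤′-step; _%_; z≤n; s≤s; z<s; s<s)
open import Data.Nat.Properties
open import Data.Nat.DivMod using ([m+kn]%n≡m%n)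
open import Data.Nat.Induction using (<-rec; <-wellFounded)
open import Data.Nat.Logarithm using (⌊log₂⌋-mono-≤; ⌊log₂⌊n/2⌋⌋≡⌊log₂n⌋∸1)
open import Data.Nat.Tactic.RingSolver using (solve-∀)
open import Data.Product using (∃₂; _,_; proj₁)
open import Data.Sum using (_⊎_; inj₁; inj₂; [_,_]′)
open import Induction.WellFounded using (module All; module FixPoint)
open import Relation.Nullary using (¬_; does; yes; no; contradiction)
open import Relation.Nullary.Decidable using (does-⇔; dec-false)
open import Relation.Unary using (Pred; Decidable)
open import Relation.Binary.PropositionalEquality
  using (_≢_; refl; sym; trans; cong; cong₂; subst; module ≡-Reasoning)

private
  variable
    p q : Level
    P : Pred ℕ p
    Q : Pred ℕ q

-- Counting below a bound

count< : Decidable P → ℕ → ℕ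
count< P? N = length (filter P? (upTo N))

count<-suc : (P? : Decidable P) → ∀ N → count< P? (suc N) ≡ count< P? N + (if does (P? N) then 1 else 0)
count<-suc P? N = begin
  length (filter P? (upTo (suc N)))              ≡⟨ cong (length ∘ filter P?) (sym (upTo-∷ʳ N)) ⟩
  length (filter P? (upTo N ++ [ N ]))           ≡⟨ cong length (filter-++ P? (upTo N) [ N ]) ⟩
  length (filter P? (upTo N) ++ filter P? [ N ]) ≡⟨ length-++ (filter P? (upTo N)) ⟩
  count< P? N + length (filter P? [ N ])         ≡⟨ cong (count< P? N +_) last ⟩
  count< P? N + (if does (P? N) then 1 else 0)   ∎
  where
  open ≡-Reasoning
  last : length (filter P? [ N ]) ≡ (if does (P? N) then 1 else 0)
  last with does (P? N)
  ... | true  = refl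
  ... | false = refl

count<-cong : (P? : Decidable P) (Q? : Decidable Q) → ∀ N →
              (∀ {i} → i < N → P i ⇔ Q i) → count< P? N ≡ count< Q? N
count<-cong P? Q? zero    _   = refl
count<-cong P? Q? (suc N) P⇔Q = begin
  count< P? (suc N)                            ≡⟨ count<-suc P? N ⟩
  count< P? N + (if does (P? N) then 1 else 0) ≡⟨ cong₂ (λ a b → a + (if b then 1 else 0))
                                                      (count<-cong P? Q? N (P⇔Q ∘ m<n⇒m<1+n))
                                                      (does-⇔ (P⇔Q (n<1+n N)) (P? N) (Q? N)) ⟩
  count< Q? N + (if does (Q? N) then 1 else 0) ≡⟨ sym (count<-suc Q? N) ⟩
  count< Q? (suc N)                            ∎
  where open ≡-Reasoning

count<-none : (P? : Decidable P) → ∀ N → (∀ {i} → i < N → ¬ P i) → count< P? N ≡ 0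
count<-none P? zero    _    = refl
count<-none P? (suc N) none = begin
  count< P? (suc N)                            ≡⟨ count<-suc P? N ⟩
  count< P? N + (if does (P? N) then 1 else 0) ≡⟨ cong₂ (λ a b → a + (if b then 1 else 0))
                                                      (count<-none P? N (none ∘ m<n⇒m<1+n))
                                                      (dec-false (P? N) (none (n<1+n N))) ⟩
  0                                            ∎
  where open ≡-Reasoning

count<-+ : (P? : Decidable P) → ∀ M N → count< P? (M + N) ≡ count< P? M + count< (λ i → P? (M + i)) N
count<-+ P? M zero    = trans (cong (count< P?) (+-identityʳ M)) (sym (+-identityʳ _))
count<-+ P? M (suc N) = begin
  count< P? (M + suc N)                          ≡⟨ cong (count< P?) (+-suc M N) ⟩
  count< P? (suc (M + N))                        ≡⟨ count<-suc P? (M + N) ⟩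
  count< P? (M + N) + last                       ≡⟨ cong (_+ last) (count<-+ P? M N) ⟩
  count< P? M + count< P?ₘ N + last              ≡⟨ +-assoc (count< P? M) _ last ⟩
  count< P? M + (count< P?ₘ N + last)            ≡⟨ cong (count< P? M +_) (sym (count<-suc P?ₘ N)) ⟩
  count< P? M + count< P?ₘ (suc N)               ∎
  where
  open ≡-Reasoning
  P?ₘ = λ i → P? (M + i)
  last = if does (P? (M + N)) then 1 else 0

count<-reverse : (P? : Decidable P) → ∀ N → count< P? N ≡ count< (λ j → P? (N ∸ suc j)) N
count<-reverse P? zero    = refl
count<-reverse P? (suc N) = begin
  count< P? (suc N)          ≡⟨ count<-suc P? N ⟩
  count< P? N + last         ≡⟨ cong (_+ last) (count<-reverse P? N) ⟩
  count< P?ʳ N + last        ≡⟨ +-comm _ last ⟩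
  last + count< P?ʳ N        ≡⟨ cong (_+ count< P?ʳ N) (sym (count<-suc R? 0)) ⟩
  count< R? 1 + count< P?ʳ N ≡⟨ sym (count<-+ R? 1 N) ⟩
  count< R? (suc N)          ∎
  where
  open ≡-Reasoning
  P?ʳ = λ j → P? (N ∸ suc j)
  R? = λ j → P? (suc N ∸ suc j)
  last = if does (P? N) then 1 else 0

-- Halving and powers of two

n<2*m⇒⌊n/2⌋<m : ∀ {n m} → n < 2 * m → ⌊ n /2⌋ < m
n<2*m⇒⌊n/2⌋<m {n} {m} n<2m = begin-strict
  ⌊ n /2⌋       <⟨ n<1+n _ ⟩
  ⌈ suc n /2⌉   ≤⟨ ⌈n/2⌉-mono (subst (suc n ≤_) (cong (m +_) (+-identityʳ m)) n<2m) ⟩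
  ⌈ m + m /2⌉   ≡⟨ sym (n≡⌈n+n/2⌉ m) ⟩
  m             ∎
  where open ≤-Reasoning

⌊2*m+n/2⌋≡m+⌊n/2⌋ : ∀ m n → ⌊ 2 * m + n /2⌋ ≡ m + ⌊ n /2⌋
⌊2*m+n/2⌋≡m+⌊n/2⌋ zero    n = refl
⌊2*m+n/2⌋≡m+⌊n/2⌋ (suc m) n = trans (cong (λ x → ⌊ x + n /2⌋) (*-suc 2 m))
                                    (cong suc (⌊2*m+n/2⌋≡m+⌊n/2⌋ m n))

[2*m+n]%2≡n%2 : ∀ m n → (2 * m + n) % 2 ≡ n % 2
[2*m+n]%2≡n%2 m n = trans (cong (_% 2) (trans (+-comm (2 * m) n) (cong (n +_) (*-comm 2 m))))
                          ([m+kn]%n≡m%n n m 2)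

n<2^n : ∀ n → n < 2 ^ n
n<2^n zero    = z<s
n<2^n (suc n) = begin-strict
  suc n                <⟨ s<s (n<2^n n) ⟩
  suc (2 ^ n)          ≡⟨ +-comm 1 (2 ^ n) ⟩
  2 ^ n + 1            ≤⟨ +-monoʳ-≤ (2 ^ n) (≤-trans (m^n>0 2 n) (m≤m+n _ 0)) ⟩
  2 ^ suc n            ∎
  where open ≤-Reasoning

2^B+w<2^[1+B] : ∀ {B w} → w < 2 ^ B → 2 ^ B + w < 2 ^ suc B
2^B+w<2^[1+B] {B} {w} w<2^B = subst (λ x → 2 ^ B + w < 2 ^ B + x) (sym (+-identityʳ (2 ^ B)))
                                    (+-monoʳ-< (2 ^ B) w<2^B)

suc[i+j]≡2*N⇒N≤i⊎N≤j : ∀ {i j N} → suc (i + j) ≡ 2 * N → N ≤ i ⊎ N ≤ j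
suc[i+j]≡2*N⇒N≤i⊎N≤j {i} {j} {N} e with N ≤? i | N ≤? j
... | yes N≤i | _       = inj₁ N≤i
... | no _    | yes N≤j = inj₂ N≤j
... | no N≰i  | no N≰j  =
  contradiction (subst (_≤ N + N) (cong suc (+-suc i j)) (+-mono-≤ (≰⇒> N≰i) (≰⇒> N≰j)))
                (<-irrefl (trans e (cong (N +_) (+-identityʳ N))))

pow2-decompose : ∀ {u} → 0 < u → ∃₂ λ B t → t < 2 ^ B × u ≡ 2 ^ B + t
pow2-decompose {suc zero}    _ = 0 , 0 , z<s , refl
pow2-decompose {suc (suc u)} _ with pow2-decompose {suc u} z<s
... | B , t , t<2^B , e with suc t <? 2 ^ B
...   | yes 1+t<2^B = B , suc t , 1+t<2^B , trans (cong suc e) (sym (+-suc (2 ^ B) t))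
...   | no  1+t≮2^B = suc B , 0 , m^n>0 2 (suc B) , doubled
  where
  open ≡-Reasoning
  doubled : suc (suc u) ≡ 2 ^ suc B + 0
  doubled = begin
    suc (suc u)            ≡⟨ cong suc e ⟩
    suc (2 ^ B + t)        ≡⟨ sym (+-suc (2 ^ B) t) ⟩
    2 ^ B + suc t          ≡⟨ cong (2 ^ B +_) (≤-antisym t<2^B (≮⇒≥ 1+t≮2^B)) ⟩
    2 ^ B + 2 ^ B          ≡⟨ cong (2 ^ B +_) (sym (+-identityʳ (2 ^ B))) ⟩
    2 ^ suc B              ≡⟨ sym (+-identityʳ (2 ^ suc B)) ⟩
    2 ^ suc B + 0          ∎

⌊log₂[2^B+w]⌋≡B : ∀ B {w} → w < 2 ^ B → ⌊log₂ (2 ^ B + w) ⌋ ≡ B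
⌊log₂[2^B+w]⌋≡B zero    {zero}  _ = refl
⌊log₂[2^B+w]⌋≡B zero    {suc _} (s≤s ())
⌊log₂[2^B+w]⌋≡B (suc B) {w} w<2^B
  with ⌊log₂ (2 * 2 ^ B + w) ⌋ in eq | ⌊log₂⌊n/2⌋⌋≡⌊log₂n⌋∸1 (2 * 2 ^ B + w)
... | zero  | _    = contradiction (subst (1 ≤_) eq (⌊log₂⌋-mono-≤ 2≤x)) λ ()
  where
  2≤x : 2 ≤ 2 * 2 ^ B + w
  2≤x = ≤-trans (*-monoʳ-≤ 2 (m^n>0 2 B)) (m≤m+n _ w)
... | suc L | half = cong suc (trans (sym half) (trans (cong ⌊log₂_⌋ (⌊2*m+n/2⌋≡m+⌊n/2⌋ (2 ^ B) w))
                                                        (⌊log₂[2^B+w]⌋≡B B (n<2*m⇒⌊n/2⌋<m w<2^B))))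

⌈n/2⌉+⌊n/2⌋≡n : ∀ n → ⌈ n /2⌉ + ⌊ n /2⌋ ≡ n
⌈n/2⌉+⌊n/2⌋≡n n = trans (+-comm ⌈ n /2⌉ ⌊ n /2⌋) (⌊n/2⌋+⌈n/2⌉≡n n)

2≤n⇒⌈n/2⌉<n : ∀ {n} → 2 ≤ n → ⌈ n /2⌉ < n
2≤n⇒⌈n/2⌉<n {suc (suc n)} _ = ⌈n/2⌉<n n
2≤n⇒⌈n/2⌉<n {suc zero} (s≤s ())

2≤n⇒⌊n/2⌋<n : ∀ {n} → 2 ≤ n → ⌊ n /2⌋ < n
2≤n⇒⌊n/2⌋<n {suc (suc n)} _ = ⌊n/2⌋<n (suc n)
2≤n⇒⌊n/2⌋<n {suc zero} (s≤s ())

-- Binary digit sums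

digitSum₂-zero : ∀ k → digitSum₂ k 0 ≡ 0
digitSum₂-zero zero    = refl
digitSum₂-zero (suc k) = digitSum₂-zero k

digitSum₂-fuel : ∀ k k' {m} → m < 2 ^ k → m < 2 ^ k' → digitSum₂ k m ≡ digitSum₂ k' m
digitSum₂-fuel zero    k'       {zero}  _ _ = sym (digitSum₂-zero k')
digitSum₂-fuel zero    _        {suc _} (s≤s ()) _
digitSum₂-fuel (suc k) zero     {zero}  _ _ = digitSum₂-zero (suc k)
digitSum₂-fuel (suc k) zero     {suc _} _ (s≤s ())
digitSum₂-fuel (suc k) (suc k') {m} m<2^k m<2^k' =
  cong (m % 2 +_) (digitSum₂-fuel k k' (n<2*m⇒⌊n/2⌋<m m<2^k) (n<2*m⇒⌊n/2⌋<m m<2^k'))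

s≡digitSum₂ : ∀ {k m} → m < 2 ^ k → s m ≡ digitSum₂ k m
s≡digitSum₂ {k} {m} = digitSum₂-fuel m k (n<2^n m)

digitSum₂-top : ∀ B {w} → w < 2 ^ B → digitSum₂ (suc B) (2 ^ B + w) ≡ suc (digitSum₂ B w)
digitSum₂-top zero    {zero}  _ = refl
digitSum₂-top zero    {suc _} (s≤s ())
digitSum₂-top (suc B) {w} w<2^B = begin
  (2 * 2 ^ B + w) % 2 + digitSum₂ (suc B) ⌊ 2 * 2 ^ B + w /2⌋
    ≡⟨ cong₂ _+_ ([2*m+n]%2≡n%2 (2 ^ B) w)
                 (cong (digitSum₂ (suc B)) (⌊2*m+n/2⌋≡m+⌊n/2⌋ (2 ^ B) w)) ⟩
  w % 2 + digitSum₂ (suc B) (2 ^ B + ⌊ w /2⌋)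
    ≡⟨ cong (w % 2 +_) (digitSum₂-top B (n<2*m⇒⌊n/2⌋<m w<2^B)) ⟩
  w % 2 + suc (digitSum₂ B ⌊ w /2⌋)
    ≡⟨ +-suc (w % 2) _ ⟩
  suc (digitSum₂ (suc B) w) ∎
  where open ≡-Reasoning

s-top : ∀ B {w} → w < 2 ^ B → s (2 ^ B + w) ≡ suc (s w)
s-top B {w} w<2^B = begin
  s (2 ^ B + w)                   ≡⟨ s≡digitSum₂ {suc B} (2^B+w<2^[1+B] {B} w<2^B) ⟩
  digitSum₂ (suc B) (2 ^ B + w)   ≡⟨ digitSum₂-top B w<2^B ⟩
  suc (digitSum₂ B w)             ≡⟨ cong suc (sym (s≡digitSum₂ {B} w<2^B)) ⟩
  suc (s w)                       ∎
  where open ≡-Reasoning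

s-complement : ∀ B {i j} → suc (i + j) ≡ 2 ^ B → s i + s j ≡ B
s-complement zero    {zero}  {zero}  _ = refl
s-complement zero    {zero}  {suc _} ()
s-complement zero    {suc _}         ()
s-complement (suc B) {i} {j} e =
  [ top-half {i} {j} e
  , (λ 2^B≤j → trans (+-comm (s i) (s j)) (top-half {j} {i} (trans (cong suc (+-comm j i)) e) 2^B≤j))
  ]′
  (suc[i+j]≡2*N⇒N≤i⊎N≤j e)
  where
  top-half : ∀ {i j} → suc (i + j) ≡ 2 ^ suc B → 2 ^ B ≤ i → s i + s j ≡ suc B
  top-half {j = j} e 2^B≤i with i' , refl ← m≤n⇒∃[o]m+o≡n 2^B≤i = begin
    s (2 ^ B + i') + s j ≡⟨ cong (_+ s j) (s-top B i'<2^B) ⟩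
    suc (s i' + s j)     ≡⟨ cong suc (s-complement B {i'} {j} e') ⟩
    suc B                ∎
    where
    open ≡-Reasoning
    shift : ∀ a b c → suc (a + b + c) ≡ a + suc (b + c)
    shift = solve-∀
    e' : suc (i' + j) ≡ 2 ^ B
    e' = +-cancelˡ-≡ (2 ^ B) _ _ (trans (sym (shift (2 ^ B) i' j))
                                   (trans e (cong (2 ^ B +_) (+-identityʳ (2 ^ B)))))
    i'<2^B : i' < 2 ^ B
    i'<2^B = ≤-trans (s≤s (m≤m+n i' j)) (≤-reflexive e')

-- Preimages of f

f-inflationary : ∀ v → v ≤ f v
f-inflationary v = m≤m+n v (s v)

f-top : ∀ B {w} → w < 2 ^ B → f (2 ^ B + w) ≡ 2 ^ B + suc (f w)
f-top B {w} w<2^B = begin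
  2 ^ B + w + s (2 ^ B + w)  ≡⟨ cong (2 ^ B + w +_) (s-top B w<2^B) ⟩
  2 ^ B + w + suc (s w)      ≡⟨ shift (2 ^ B) w (s w) ⟩
  2 ^ B + suc (w + s w)      ∎
  where
  open ≡-Reasoning
  shift : ∀ a b c → a + b + suc c ≡ a + suc (b + c)
  shift = solve-∀

f-complement : ∀ B {v i} → suc (v + i) ≡ 2 ^ B → suc (f v + f i) ≡ 2 ^ B + B
f-complement B {v} {i} e = begin
  suc (v + s v + (i + s i))  ≡⟨ shuffle v (s v) i (s i) ⟩
  suc (v + i) + (s v + s i)  ≡⟨ cong₂ _+_ e (s-complement B {v} {i} e) ⟩
  2 ^ B + B                  ∎
  where
  open ≡-Reasoning
  shuffle : ∀ a b c d → suc (a + b + (c + d)) ≡ suc (a + c) + (b + d)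
  shuffle = solve-∀

preimages : ℕ → ℕ → ℕ → ℕ
preimages k x N = count< (λ i → k + f i ≟ x) N

F≡preimages : ∀ {u N} → u < N → F u ≡ preimages 0 u N
F≡preimages {u} {N} u<N = begin
  F u                                 ≡⟨ sym (+-identityʳ (F u)) ⟩
  F u + 0                             ≡⟨ cong (F u +_) (sym (count<-none P?⁺ (N ∸ suc u) beyond)) ⟩
  F u + count< P?⁺ (N ∸ suc u)        ≡⟨ sym (count<-+ (λ v → f v ≟ u) (suc u) (N ∸ suc u)) ⟩
  preimages 0 u (suc u + (N ∸ suc u)) ≡⟨ cong (preimages 0 u) (m+[n∸m]≡n u<N) ⟩
  preimages 0 u N                     ∎
  where
  open ≡-Reasoning
  P?⁺ = λ i → f (suc u + i) ≟ u
  beyond : ∀ {i} → i < N ∸ suc u → f (suc u + i) ≢ u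
  beyond {i} _ fi≡u = <⇒≢ (≤-trans (m≤m+n (suc u) i) (f-inflationary (suc u + i))) (sym fi≡u)

preimages-shift : ∀ {k u N} → u < N → preimages k (k + u) N ≡ F u
preimages-shift {k} {u} {N} u<N =
  trans (count<-cong _ _ N (λ _ → mk⇔ (+-cancelˡ-≡ k _ _) (cong (k +_)))) (sym (F≡preimages u<N))

preimages-none : ∀ k {x} N → x < k → preimages k x N ≡ 0
preimages-none k {x} N x<k = count<-none _ N (λ {i} _ e → <⇒≢ (<-≤-trans x<k (m≤m+n k (f i))) (sym e))

complement-target : ∀ {x y P B} t → suc (x + y) ≡ P + B → (x ≡ P + t) ⇔ (suc t + y ≡ B)
complement-target {x} {y} {P} {B} t e = mk⇔ to from
  where
  shift : ∀ P t y → P + (suc t + y) ≡ suc (P + t + y)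
  shift = solve-∀
  to : x ≡ P + t → suc t + y ≡ B
  to refl = +-cancelˡ-≡ P _ _ (trans (shift P t y) e)
  from : suc t + y ≡ B → x ≡ P + t
  from refl = +-cancelʳ-≡ y x (P + t) (suc-injective (trans e (shift P t y)))

F-split : ∀ B {t} → t < 2 ^ B → F (2 ^ B + t) ≡ preimages (suc t) B (2 ^ B) + preimages 1 t (2 ^ B)
F-split B {t} t<2^B = begin
  F u                                                 ≡⟨ F≡preimages (+-monoʳ-< (2 ^ B) t<2^B) ⟩
  preimages 0 u (2 ^ B + 2 ^ B)                       ≡⟨ count<-+ (λ v → f v ≟ u) (2 ^ B) (2 ^ B) ⟩
  preimages 0 u (2 ^ B) + count< P?ʰ (2 ^ B)          ≡⟨ cong₂ _+_ low high ⟩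
  preimages (suc t) B (2 ^ B) + preimages 1 t (2 ^ B) ∎
  where
  open ≡-Reasoning
  u = 2 ^ B + t
  P?ʰ = λ w → f (2 ^ B + w) ≟ u
  low : preimages 0 u (2 ^ B) ≡ preimages (suc t) B (2 ^ B)
  low = trans (count<-reverse (λ v → f v ≟ u) (2 ^ B)) (count<-cong _ _ (2 ^ B) λ {j} j<2^B →
          complement-target t (f-complement B {2 ^ B ∸ suc j} {j}
            (trans (sym (+-suc (2 ^ B ∸ suc j) j)) (m∸n+n≡m j<2^B))))
  high : count< P?ʰ (2 ^ B) ≡ preimages 1 t (2 ^ B)
  high = count<-cong _ _ (2 ^ B) λ w<2^B →
           mk⇔ (λ e → +-cancelˡ-≡ (2 ^ B) _ _ (trans (sym (f-top B w<2^B)) e))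
               (λ e → trans (f-top B w<2^B) (cong (2 ^ B +_) e))

F0≡1 : F 0 ≡ 1
F0≡1 = refl

F1≡0 : F 1 ≡ 0
F1≡0 = refl

combine : ℕ → ℕ → ℕ
combine c t = 2 ^ (c + t + 2) + 1 + t

combine≡2^+suc : ∀ c t → combine c t ≡ 2 ^ (c + t + 2) + suc t
combine≡2^+suc c t = +-assoc (2 ^ (c + t + 2)) 1 t

combine-exponent : ∀ c t → c + t + 2 ≡ 2 + t + c
combine-exponent = solve-∀

c<2^[c+t+2] : ∀ c t → c < 2 ^ (c + t + 2)
c<2^[c+t+2] c t = <-trans (subst (c <_) (sym (combine-exponent c t)) (m<n+m c z<s)) (n<2^n _)

1+t<2^[c+t+2] : ∀ c t → suc t < 2 ^ (c + t + 2)
1+t<2^[c+t+2] c t = <-trans (subst (suc t <_) (sym (combine-exponent c t)) (s≤s (m≤m+n (suc t) c))) (n<2^n _)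

2^≤combine : ∀ c t → 2 ^ (c + t + 2) ≤ combine c t
2^≤combine c t = ≤-trans (m≤m+n _ 1) (m≤m+n _ t)

combine<2^ : ∀ c t → combine c t < 2 ^ suc (c + t + 2)
combine<2^ c t = subst (_< 2 ^ suc (c + t + 2)) (sym (combine≡2^+suc c t))
                       (2^B+w<2^[1+B] {c + t + 2} (1+t<2^[c+t+2] c t))

4≤combine : ∀ c t → 4 ≤ combine c t
4≤combine c t = ≤-trans (^-monoʳ-≤ 2 (m≤n+m 2 (c + t))) (2^≤combine c t)

c<combine : ∀ c t → c < combine c t
c<combine c t = <-≤-trans (c<2^[c+t+2] c t) (2^≤combine c t)

t<combine : ∀ c t → t < combine c t
t<combine c t = m<n+m t (m≤n+m 1 (2 ^ (c + t + 2)))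

combine-<-mono : ∀ {c t c' t'} → c + t < c' + t' → combine c t < combine c' t'
combine-<-mono {c} {t} {c'} {t'} lt = begin-strict
  combine c t             <⟨ combine<2^ c t ⟩
  2 ^ suc (c + t + 2)     ≤⟨ ^-monoʳ-≤ 2 (+-monoˡ-≤ 2 lt) ⟩
  2 ^ (c' + t' + 2)       ≤⟨ 2^≤combine c' t' ⟩
  combine c' t'           ∎
  where open ≤-Reasoning

combine-≤-mono : ∀ {c t c' t'} → c + t ≡ c' + t' → t ≤ t' → combine c t ≤ combine c' t'
combine-≤-mono {c} {t} {c'} {t'} e t≤t' =
  subst (λ E → combine c t ≤ 2 ^ (E + 2) + 1 + t') e (+-monoʳ-≤ (2 ^ (c + t + 2) + 1) t≤t')

⌊log₂combine⌋ : ∀ c t → ⌊log₂ (combine c t) ⌋ ≡ c + t + 2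
⌊log₂combine⌋ c t = trans (cong ⌊log₂_⌋ (combine≡2^+suc c t))
                          (⌊log₂[2^B+w]⌋≡B (c + t + 2) (1+t<2^[c+t+2] c t))

F-combine : ∀ c t → F (combine c t) ≡ F c + F t
F-combine c t = begin
  F (combine c t)                                           ≡⟨ cong F (combine≡2^+suc c t) ⟩
  F (2 ^ B + suc t)                                         ≡⟨ F-split B (1+t<2^[c+t+2] c t) ⟩
  preimages (2 + t) B (2 ^ B) + preimages 1 (suc t) (2 ^ B) ≡⟨ cong₂ _+_ low high ⟩
  F c + F t                                                 ∎
  where
  open ≡-Reasoning
  B = c + t + 2
  low : preimages (2 + t) B (2 ^ B) ≡ F c
  low = trans (cong (λ x → preimages (2 + t) x (2 ^ B)) (combine-exponent c t))
              (preimages-shift (c<2^[c+t+2] c t))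
  high : preimages 1 (suc t) (2 ^ B) ≡ F t
  high = preimages-shift (<-trans (n<1+n t) (1+t<2^[c+t+2] c t))

data Reduction (u : ℕ) : Set where
  smaller  : ∀ w → w < u → F w ≡ F u → Reduction u
  combined : ∀ c t → u ≡ combine c t → 0 < F c → 0 < F t → Reduction u

combine-reduction : ∀ c t → Reduction (combine c t)
combine-reduction c t with F c ≟ 0 | F t ≟ 0
... | yes Fc≡0 | _        = smaller t (t<combine c t) (sym (trans (F-combine c t) (cong (_+ F t) Fc≡0)))
... | no _     | yes Ft≡0 = smaller c (c<combine c t)
                              (sym (trans (F-combine c t) (trans (cong (F c +_) Ft≡0) (+-identityʳ (F c)))))
... | no Fc≢0  | no Ft≢0  = combined c t refl (n≢0⇒n>0 Fc≢0) (n≢0⇒n>0 Ft≢0)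

pow2-reduction : ∀ B {t} → t < 2 ^ B → 0 < F (2 ^ B + t) → Reduction (2 ^ B + t)
pow2-reduction zero    {zero}  _ 0<F1 = contradiction (subst (0 <_) F1≡0 0<F1) (<-irrefl refl)
pow2-reduction (suc B) {zero}  _ _ = smaller B (<-≤-trans B<2^[1+B] (m≤m+n _ 0)) (sym (begin
  F (2 ^ suc B + 0)                                            ≡⟨ F-split (suc B) (m^n>0 2 (suc B)) ⟩
  preimages 1 (suc B) (2 ^ suc B) + preimages 1 0 (2 ^ suc B)
    ≡⟨ cong₂ _+_ (preimages-shift B<2^[1+B]) (preimages-none 1 (2 ^ suc B) z<s) ⟩
  F B + 0                                                      ≡⟨ +-identityʳ (F B) ⟩
  F B                                                          ∎))
  where
  open ≡-Reasoning
  B<2^[1+B] : B < 2 ^ suc B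
  B<2^[1+B] = <-trans (n<1+n B) (n<2^n (suc B))
pow2-reduction B {suc t} 1+t<2^B _ with 2 + t ≤? B
... | no  B≱2+t = smaller t (m≤n+m (suc t) (2 ^ B)) (sym (begin
  F (2 ^ B + suc t)                                            ≡⟨ F-split B 1+t<2^B ⟩
  preimages (2 + t) B (2 ^ B) + preimages 1 (suc t) (2 ^ B)
    ≡⟨ cong₂ _+_ (preimages-none (2 + t) (2 ^ B) (≰⇒> B≱2+t))
                 (preimages-shift (<-trans (n<1+n t) 1+t<2^B)) ⟩
  F t                                                          ∎))
  where open ≡-Reasoning
... | yes 2+t≤B with c , refl ← m≤n⇒∃[o]m+o≡n 2+t≤B =
  subst Reduction (trans (cong (λ E → 2 ^ E + 1 + t) (combine-exponent c t)) (+-assoc _ 1 t))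
                  (combine-reduction c t)

F-reduction : ∀ {u} → 0 < u → 0 < F u → Reduction u
F-reduction 0<u 0<Fu with B , t , t<2^B , u≡2^B+t ← pow2-decompose 0<u =
  subst Reduction (sym u≡2^B+t) (pow2-reduction B t<2^B (subst (λ v → 0 < F v) u≡2^B+t 0<Fu))

-- The recursion for K

-- K 0 is a junk value (the least u with F u = 0 is 1); it is chosen so that K is monotone.
K-step : (n : ℕ) → (∀ {m} → m < n → ℕ) → ℕ
K-step zero          _  = 0
K-step (suc zero)    _  = 0
K-step (suc (suc n)) K< = combine (K< (⌈n/2⌉<n n)) (K< (⌊n/2⌋<n (suc n)))

opaque
  K : ℕ → ℕ
  K = All.wfRec <-wellFounded 0ℓ (λ _ → ℕ) K-step

  K-unfold : ∀ n → K n ≡ K-step n (λ {m} _ → K m)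
  K-unfold n = FixPoint.unfold-wfRec <-wellFounded (λ _ → ℕ) K-step K-step-ext {n}
    where
    K-step-ext : ∀ n {IH IH′ : ∀ {m} → m < n → ℕ} →
                 (∀ {m} (m<n : m < n) → IH m<n ≡ IH′ m<n) → K-step n IH ≡ K-step n IH′
    K-step-ext zero          _  = refl
    K-step-ext (suc zero)    _  = refl
    K-step-ext (suc (suc n)) eq = cong₂ combine (eq _) (eq _)

K-0 : K 0 ≡ 0
K-0 = K-unfold 0

K-1 : K 1 ≡ 0
K-1 = K-unfold 1

K-combine : ∀ {n} → 2 ≤ n → K n ≡ combine (K ⌈ n /2⌉) (K ⌊ n /2⌋)
K-combine {suc (suc n)} _ = K-unfold (suc (suc n))
K-combine {suc zero} (s≤s ())

4≤K : ∀ {n} → 2 ≤ n → 4 ≤ K n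
4≤K {n} 2≤n = subst (4 ≤_) (sym (K-combine 2≤n)) (4≤combine (K ⌈ n /2⌉) (K ⌊ n /2⌋))

2*m<n∧4≤n⇒m+2≤n : ∀ {m n} → 2 * m < n → 4 ≤ n → m + 2 ≤ n
2*m<n∧4≤n⇒m+2≤n {zero}  _     4≤n = ≤-trans (s≤s (s≤s z≤n)) 4≤n
2*m<n∧4≤n⇒m+2≤n {suc m} 2m<n _   =
  ≤-trans (m≤m+n (suc m + 2) m) (≤-trans (≤-reflexive (identity m)) 2m<n)
  where
  identity : ∀ m → suc m + 2 + m ≡ suc (2 * suc m)
  identity = solve-∀

K-grows : ∀ {n} → 2 ≤ n → 2 * K (n ∸ 1) < K n
K-grows {n} = <-rec (λ n → 2 ≤ n → 2 * K (n ∸ 1) < K n) grows n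
  where
  grows : ∀ n → (∀ {m} → m < n → 2 ≤ m → 2 * K (m ∸ 1) < K m) → 2 ≤ n → 2 * K (n ∸ 1) < K n
  grows (suc zero) _ (s≤s ())
  grows (suc (suc zero)) _ 2≤2 = subst (λ k → 2 * k < K 2) (sym K-1) (≤-trans (s≤s z≤n) (4≤K 2≤2))
  grows n@(suc (suc (suc k))) IH 2≤n = begin-strict
    2 * K m                   ≡⟨ cong (2 *_) (K-combine {m} (s≤s (s≤s z≤n))) ⟩
    2 * combine A z           <⟨ *-monoʳ-< 2 (combine<2^ A z) ⟩
    2 ^ (2 + (A + z + 2))     ≤⟨ ^-monoʳ-≤ 2 exponent≤ ⟩
    2 ^ (Z + A + 2)           ≤⟨ 2^≤combine Z A ⟩
    combine Z A               ≡⟨ sym (K-combine 2≤n) ⟩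
    K n                       ∎
    where
    open ≤-Reasoning
    m = suc (suc k)
    A = K ⌈ m /2⌉
    z = K ⌊ m /2⌋
    Z = K ⌈ n /2⌉
    2≤⌈n/2⌉ : 2 ≤ ⌈ n /2⌉
    2≤⌈n/2⌉ = ⌈n/2⌉-mono {3} (s≤s (s≤s (s≤s z≤n)))
    z+2≤Z : z + 2 ≤ Z
    z+2≤Z = 2*m<n∧4≤n⇒m+2≤n (IH (⌈n/2⌉<n (suc k)) 2≤⌈n/2⌉) (4≤K 2≤⌈n/2⌉)
    shuffle : ∀ A z → z + 2 + A + 2 ≡ 2 + (A + z + 2)
    shuffle = solve-∀
    exponent≤ : 2 + (A + z + 2) ≤ Z + A + 2
    exponent≤ = subst (_≤ Z + A + 2) (shuffle A z) (+-monoˡ-≤ 2 (+-monoˡ-≤ A z+2≤Z))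

K-≤-suc : ∀ m → K m ≤ K (suc m)
K-≤-suc zero    = subst (_≤ K 1) (sym K-0) z≤n
K-≤-suc (suc m) = ≤-trans (m≤m+n (K (suc m)) _) (<⇒≤ (K-grows {suc (suc m)} (s≤s (s≤s z≤n))))

K-mono : ∀ {m n} → m ≤ n → K m ≤ K n
K-mono {m} m≤n = go (≤⇒≤′ m≤n)
  where
  go : ∀ {n} → m ≤′ n → K m ≤ K n
  go         ≤′-refl        = ≤-refl
  go {suc n} (≤′-step m≤′n) = ≤-trans (go m≤′n) (K-≤-suc n)

K-convex-strict : ∀ {x y n} → x + y ≡ n → y < ⌊ n /2⌋ → K ⌈ n /2⌉ + K ⌊ n /2⌋ < K x + K y
K-convex-strict {x} {y} {n} x+y≡n y<⌊n/2⌋ = <-≤-trans (halves<K ⌈n/2⌉<x) (m≤m+n (K x) (K y))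
  where
  ⌈n/2⌉<x : ⌈ n /2⌉ < x
  ⌈n/2⌉<x = ≰⇒> λ x≤⌈n/2⌉ →
    <-irrefl (trans x+y≡n (sym (⌈n/2⌉+⌊n/2⌋≡n n))) (+-mono-≤-< x≤⌈n/2⌉ y<⌊n/2⌋)
  1≤⌈n/2⌉ : 1 ≤ ⌈ n /2⌉
  1≤⌈n/2⌉ = ≤-trans (≤-trans (s≤s z≤n) y<⌊n/2⌋) (⌊n/2⌋≤⌈n/2⌉ n)
  halves<K : ∀ {z} → ⌈ n /2⌉ < z → K ⌈ n /2⌉ + K ⌊ n /2⌋ < K z
  halves<K {suc z} (s≤s ⌈n/2⌉≤z) = begin-strict
    K ⌈ n /2⌉ + K ⌊ n /2⌋  ≤⟨ +-mono-≤ (K-mono ⌈n/2⌉≤z)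
                                        (K-mono (≤-trans (⌊n/2⌋≤⌈n/2⌉ n) ⌈n/2⌉≤z)) ⟩
    K z + K z              ≡⟨ cong (K z +_) (sym (+-identityʳ (K z))) ⟩
    2 * K z                <⟨ K-grows {suc z} (s≤s (≤-trans 1≤⌈n/2⌉ ⌈n/2⌉≤z)) ⟩
    K (suc z)              ∎
    where open ≤-Reasoning

K-convex-ordered : ∀ {x y n} → y ≤ x → x + y ≡ n → K ⌈ n /2⌉ + K ⌊ n /2⌋ ≤ K x + K y
K-convex-ordered {x} {y} {n} y≤x x+y≡n with y <? ⌊ n /2⌋
... | yes y<⌊n/2⌋ = <⇒≤ (K-convex-strict x+y≡n y<⌊n/2⌋)
... | no  y≮⌊n/2⌋ = +-mono-≤ (K-mono ⌈n/2⌉≤x) (K-mono (≮⇒≥ y≮⌊n/2⌋))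
  where
  ⌈n/2⌉≤x : ⌈ n /2⌉ ≤ x
  ⌈n/2⌉≤x = ≤-trans (⌈n/2⌉-mono (subst (_≤ x + x) x+y≡n (+-monoʳ-≤ x y≤x)))
                    (≤-reflexive (sym (n≡⌈n+n/2⌉ x)))

K-convex : ∀ {x y n} → x + y ≡ n → K ⌈ n /2⌉ + K ⌊ n /2⌋ ≤ K x + K y
K-convex {x} {y} {n} x+y≡n with ≤-total y x
... | inj₁ y≤x = K-convex-ordered y≤x x+y≡n
... | inj₂ x≤y = subst (K ⌈ n /2⌉ + K ⌊ n /2⌋ ≤_) (+-comm (K y) (K x))
                       (K-convex-ordered x≤y (trans (+-comm y x) x+y≡n))

IsK-intro : ∀ {n u} → F u ≡ n → (∀ w → F w ≡ n → u ≤ w) → IsK n u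
IsK-intro Fu≡n least = Fu≡n , λ w w<u Fw≡n → <⇒≱ w<u (least w Fw≡n)

IsK-least : ∀ {n u w} → IsK n u → F w ≡ n → u ≤ w
IsK-least (_ , minimal) Fw≡n = ≮⇒≥ λ w<u → minimal _ w<u Fw≡n

module _ {n} (2≤n : 2 ≤ n) (IH : ∀ {a} → a < n → 1 ≤ a → IsK a (K a)) where

  F-K : F (K n) ≡ n
  F-K = begin
    F (K n)                              ≡⟨ cong F (K-combine 2≤n) ⟩
    F (combine (K ⌈ n /2⌉) (K ⌊ n /2⌋))  ≡⟨ F-combine (K ⌈ n /2⌉) (K ⌊ n /2⌋) ⟩
    F (K ⌈ n /2⌉) + F (K ⌊ n /2⌋)        ≡⟨ cong₂ _+_ (proj₁ IsK-⌈n/2⌉) (proj₁ IsK-⌊n/2⌋) ⟩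
    ⌈ n /2⌉ + ⌊ n /2⌋                    ≡⟨ ⌈n/2⌉+⌊n/2⌋≡n n ⟩
    n                                    ∎
    where
    open ≡-Reasoning
    IsK-⌈n/2⌉ : IsK ⌈ n /2⌉ (K ⌈ n /2⌉)
    IsK-⌈n/2⌉ = IH (2≤n⇒⌈n/2⌉<n 2≤n) (⌈n/2⌉-mono 2≤n)
    IsK-⌊n/2⌋ : IsK ⌊ n /2⌋ (K ⌊ n /2⌋)
    IsK-⌊n/2⌋ = IH (2≤n⇒⌊n/2⌋<n 2≤n) (⌊n/2⌋-mono 2≤n)

  K≤combine : ∀ c t → 0 < F c → 0 < F t → F c + F t ≡ n → K n ≤ combine c t
  K≤combine c t 0<Fc 0<Ft Fc+Ft≡n = subst (_≤ combine c t) (sym (K-combine 2≤n))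
    ([ (λ lt → <⇒≤ (combine-<-mono {K ⌈ n /2⌉} {K ⌊ n /2⌋} {c} {t} lt))
     , (λ eq → combine-≤-mono {K ⌈ n /2⌉} {K ⌊ n /2⌋} {c} {t} eq (K⌊n/2⌋≤t eq))
     ]′ (m≤n⇒m<n∨m≡n exponent≤))
    where
    K[Fc]≤c : K (F c) ≤ c
    K[Fc]≤c = IsK-least (IH (<-≤-trans (m<m+n (F c) 0<Ft) (≤-reflexive Fc+Ft≡n)) 0<Fc) refl
    K[Ft]≤t : K (F t) ≤ t
    K[Ft]≤t = IsK-least (IH (<-≤-trans (m<n+m (F t) 0<Fc) (≤-reflexive Fc+Ft≡n)) 0<Ft) refl
    exponent≤ : K ⌈ n /2⌉ + K ⌊ n /2⌋ ≤ c + t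
    exponent≤ = ≤-trans (K-convex Fc+Ft≡n) (+-mono-≤ K[Fc]≤c K[Ft]≤t)
    K⌊n/2⌋≤t : K ⌈ n /2⌉ + K ⌊ n /2⌋ ≡ c + t → K ⌊ n /2⌋ ≤ t
    K⌊n/2⌋≤t eq = ≤-trans (K-mono ⌊n/2⌋≤Ft) K[Ft]≤t
      where
      ⌊n/2⌋≤Ft : ⌊ n /2⌋ ≤ F t
      ⌊n/2⌋≤Ft = ≮⇒≥ λ Ft<⌊n/2⌋ → <⇒≱ (K-convex-strict Fc+Ft≡n Ft<⌊n/2⌋)
                                        (≤-trans (+-mono-≤ K[Fc]≤c K[Ft]≤t) (≤-reflexive (sym eq)))

  K-least : ∀ u → F u ≡ n → K n ≤ u
  K-least = <-rec (λ u → F u ≡ n → K n ≤ u) least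
    where
    least : ∀ u → (∀ {w} → w < u → F w ≡ n → K n ≤ w) → F u ≡ n → K n ≤ u
    least zero      _   F0≡n = contradiction (trans (sym F0≡1) F0≡n) (<⇒≢ 2≤n)
    least u@(suc _) rec Fu≡n with F-reduction z<s (subst (0 <_) (sym Fu≡n) (<⇒≤ 2≤n))
    ... | smaller w w<u Fw≡Fu = ≤-trans (rec w<u (trans Fw≡Fu Fu≡n)) (<⇒≤ w<u)
    ... | combined c t u≡ 0<Fc 0<Ft =
      subst (K n ≤_) (sym u≡)
        (K≤combine c t 0<Fc 0<Ft (trans (sym (F-combine c t)) (trans (cong F (sym u≡)) Fu≡n)))

K-isK : ∀ n → 1 ≤ n → IsK n (K n)
K-isK = <-rec (λ n → 1 ≤ n → IsK n (K n)) λ where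
  (suc zero)    _  _ → subst (IsK 1) (sym K-1) (F0≡1 , λ _ ())
  (suc (suc _)) IH _ → IsK-intro (F-K (s≤s (s≤s z≤n)) IH) (K-least (s≤s (s≤s z≤n)) IH)

theorem5p1 : (n : ℕ) → n ≥ 2 →
    Σ ℕ λ Kn → Σ ℕ λ Kc → Σ ℕ λ Kf → Σ ℕ λ Kp →
      IsK n Kn × IsK ⌈ n /2⌉ Kc × IsK ⌊ n /2⌋ Kf × IsK (n ∸ 1) Kp ×
      (⌊log₂ Kn ⌋ ≡ Kc + Kf + 2) ×
      (Kn ≡ 2 ^ ⌊log₂ Kn ⌋ + 1 + Kf) ×
      (Kn > 2 * Kp)
theorem5p1 n 2≤n =
  K n , K ⌈ n /2⌉ , K ⌊ n /2⌋ , K (n ∸ 1) ,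
  K-isK n (<⇒≤ 2≤n) , K-isK ⌈ n /2⌉ (⌈n/2⌉-mono 2≤n) , K-isK ⌊ n /2⌋ (⌊n/2⌋-mono 2≤n) ,
  K-isK (n ∸ 1) (∸-monoˡ-≤ 1 2≤n) ,
  log₂K , trans (K-combine 2≤n) (cong (λ B → 2 ^ B + 1 + K ⌊ n /2⌋) (sym log₂K)) , K-grows 2≤n
  where
  log₂K : ⌊log₂ K n ⌋ ≡ K ⌈ n /2⌉ + K ⌊ n /2⌋ + 2
  log₂K = trans (cong ⌊log₂_⌋ (K-combine 2≤n)) (⌊log₂combine⌋ (K ⌈ n /2⌉) (K ⌊ n /2⌋))
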